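{- For every sufficiently small $\varepsilon>0$ there is $\mu_0>0$ such that for every $\mu\in(0,\mu_0]$ there is $n_0$ such that for all $n\geq n_0$ the following holds. Let $G$ be an $\varepsilon$-superextremal two-clique on $n$ vertices with partition $V(G)=A\uplus B$, and let $Z=\{f,f'\}$ where $f,f'$ are vertex-disjoint edges each with one endpoint in $A$ and one in $B$, such that the set of edges of $G$ between $A$ and $B$ is exactly $Z$. Let $\vec H$ be a directed Hamilton cycle of $G$. Then for every $e\in E(H)\setminus Z$ there are at least $n^2/300$ pairs $(e',i)$ with $e'\in E(G)\setminus E(H)$ (taken with an ordering of its endpoints) and $i\in\{1,2\}$ such that the switching $s_i(\vec H;e,e')$ is admissible.
   Context: For $v\in V(G)$, $S\subseteq V(G)$, $d_G(v,S)$ is the number of neighbours of $v$ in $S$. A graph $G$ on $n$ vertices is an $\varepsilon$-superextremal two-clique with partition $A\uplus B$ if: (A1) $||A|-|B||\leq\varepsilon n$; (A2) $d_G(a,A)\geq(1/2-\varepsilon)n$ for all but at most $\varepsilon n$ vertices $a\in A$; (A3) $d_G(a,A)\geq(1/4-\varepsilon)n$ for all $a\in A$; (A4) $d_G(b,B)\geq(1/2-\varepsilon)n$ for all but at most $\varepsilon n$ vertices $b\in B$; (A5) $d_G(b,B)\geq(1/4-\varepsilon)n$ for all $b\in B$. A directed Hamilton cycle $\vec H$ of $G$ is a Hamilton cycle of $G$ with edges oriented so every vertex has out-degree one; $H$ is the underlying cycle and $\pi$ the successor function ($(x,\pi(x))\in E(\vec H)$). For $e=x\pi(x)\in E(H)$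 and $e'=x'y'\notin E(H)$ with $x$ on the directed path from $y'$ to $x'$ in $\vec H$, $s_1(\vec H;e,e')$ and $s_2(\vec H;e,e')$ are the directed cycles containing $(x',y')$ with underlying cycles $H_1=(H-\{e,x'\pi(x'),\pi^{ -1}(y')y'\})+\{e',x\pi(x'),\pi^{ -1}(y')\pi(x)\}$ and $H_2=(H-\{e,x'\pi(x'),\pi^{ -1}(y')y'\})+\{e',x\pi^{ -1}(y'),\pi(x)\pi(x')\}$. The switching $s_i(\vec H;e,e')$ is admissible if $H_i\subseteq G$.
   Formalization: The parameters ε and μ take only positive rational values. -}

module Defs where

open import Data.Nat as ℕ using (ℕ; zero; suc)
open import Data.Integer using (+_)
open import Data.Fin using (Fin)
open import Data.Fin.Permutation using (Permutation′; _⟨$⟩ʳ_; _⟨$⟩ˡ_)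
open import Data.Bool using (Bool; true; false; _∧_; not)
open import Data.List using (List; length; filter; allFin)
open import Data.Rational using (ℚ; _/_; _-_; _*_; _≤_; ½; 0ℚ; ∣_∣)
open import Data.Rational.Properties using (_≤?_)
open import Data.Product using (Σ; ∃; _×_; _,_)
open import Data.Sum using (_⊎_)
open import Relation.Binary.PropositionalEquality using (_≡_; _≢_)
open import Relation.Nullary using (¬_)
open import Relation.Nullary.Decidable using (⌊_⌋)

ℕ→ℚ : ℕ → ℚ
ℕ→ℚ n = (+ n) / 1

¼ : ℚ
¼ = (+ 1) / 4

record Graph (n : ℕ) : Set where
  field
    adj    : Fin n → Fin n → Bool
    sym    : ∀ u v → adj u v ≡ adj v u
    irrefl : ∀ v → adj v v ≡ false
open Graph public

Edge : ∀ {n} → Graph n → Fin n → Fin n → Set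
Edge G u v = adj G u v ≡ true

count : ∀ {n} → (Fin n → Bool) → ℕ
count {n} P = length (filter (λ v → P v ≡? true) (allFin n))
  where
  open import Data.Bool.Properties using () renaming (_≟_ to _≡?_)

deg : ∀ {n} → Graph n → Fin n → (Fin n → Bool) → ℕ
deg G v S = count (λ u → adj G v u ∧ S u)

-- a partition V(G) = A ⊎ B is given by the characteristic function of A;
-- B is its complement.
compl : ∀ {n} → (Fin n → Bool) → (Fin n → Bool)
compl S v = not (S v)

lowDegCount : ∀ {n} → ℚ → Graph n → (Fin n → Bool) → ℕ
lowDegCount {n} ε G S =
  count (λ v → S v ∧ not ⌊ (½ - ε) * ℕ→ℚ n ≤? ℕ→ℚ (deg G v S) ⌋)

CondA1 CondA2 CondA3 CondA4 CondA5 :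
  ∀ {n : ℕ} (ε : ℚ) (G : Graph n) (inA : Fin n → Bool) → Set
CondA1 {n} ε G inA = ∣ ℕ→ℚ (count inA) - ℕ→ℚ (count (compl inA)) ∣ ≤ ε * ℕ→ℚ n
CondA2 {n} ε G inA = ℕ→ℚ (lowDegCount ε G inA) ≤ ε * ℕ→ℚ n
CondA3 {n} ε G inA = ∀ a → inA a ≡ true → (¼ - ε) * ℕ→ℚ n ≤ ℕ→ℚ (deg G a inA)
CondA4 {n} ε G inA = ℕ→ℚ (lowDegCount ε G (compl inA)) ≤ ε * ℕ→ℚ n
CondA5 {n} ε G inA = ∀ b → inA b ≡ false → (¼ - ε) * ℕ→ℚ n ≤ ℕ→ℚ (deg G b (compl inA))

-- (a record here makes Agda's record checks explode on ℚ, so use a product)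
SuperExtremal : ∀ {n : ℕ} (ε : ℚ) (G : Graph n) (inA : Fin n → Bool) → Set
SuperExtremal ε G inA =
  CondA1 ε G inA × CondA2 ε G inA × CondA3 ε G inA × CondA4 ε G inA × CondA5 ε G inA

iter : ∀ {A : Set} → (A → A) → ℕ → A → A
iter f zero    x = x
iter f (suc k) x = f (iter f k x)

-- directed Hamilton cycle of G: a successor permutation π whose single
-- orbit is all of V(G), with every arc x π(x) an edge of G
record DirHamCycle {n : ℕ} (G : Graph n) : Set where
  field
    π        : Permutation′ n
    edges    : ∀ x → Edge G x (π ⟨$⟩ʳ x)
    oneCycle : ∀ x y → ∃ λ k → iter (π ⟨$⟩ʳ_) k x ≡ y
open DirHamCycle public

succ pred : ∀ {n} {G : Graph n} → DirHamCycle G → Fin n → Fin n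
succ H x = π H ⟨$⟩ʳ x
pred H x = π H ⟨$⟩ˡ x

SamePair : ∀ {n} → Fin n → Fin n → Fin n → Fin n → Set
SamePair u v a b = (u ≡ a × v ≡ b) ⊎ (u ≡ b × v ≡ a)

InH : ∀ {n} {G : Graph n} → DirHamCycle G → Fin n → Fin n → Set
InH H u v = succ H u ≡ v ⊎ succ H v ≡ u

-- x lies on the directed path from y' to x' in H, with x ≠ x'
-- (so that the edge e = x π(x) lies on this path)
OnPath : ∀ {n} {G : Graph n} → DirHamCycle G → Fin n → Fin n → Fin n → Set
OnPath H x y' x' =
  ∃ λ k → iter (succ H) k y' ≡ x × (∀ j → j ℕ.≤ k → iter (succ H) j y' ≢ x')

data SwitchIndex : Set where
  s₁ s₂ : SwitchIndex

-- edge set of H_i for e = x π(x), e' = x' y'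
Removed : ∀ {n} {G : Graph n} → DirHamCycle G → (x x' y' u v : Fin n) → Set
Removed H x x' y' u v =
  SamePair u v x (succ H x) ⊎ SamePair u v x' (succ H x') ⊎ SamePair u v (pred H y') y'

Added : ∀ {n} {G : Graph n} → DirHamCycle G → SwitchIndex → (x x' y' u v : Fin n) → Set
Added H s₁ x x' y' u v =
  SamePair u v x' y' ⊎ SamePair u v x (succ H x') ⊎ SamePair u v (pred H y') (succ H x)
Added H s₂ x x' y' u v =
  SamePair u v x' y' ⊎ SamePair u v x (pred H y') ⊎ SamePair u v (succ H x) (succ H x')

InHᵢ : ∀ {n} {G : Graph n} → DirHamCycle G → SwitchIndex → (x x' y' u v : Fin n) → Set
InHᵢ H i x x' y' u v = (InH H u v × ¬ Removed H x x' y' u v) ⊎ Added H i x x' y' u v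

-- s_i(H; e, e') with e = x π(x), e' = x' y' (ordered) is a well-defined
-- switching (e' ∈ E(G) ∖ E(H), x on the directed path from y' to x') and
-- admissible (H_i ⊆ G)
Admissible : ∀ {n} {G : Graph n} → DirHamCycle G → Fin n → (Fin n × Fin n × SwitchIndex) → Set
Admissible {G = G} H x (x' , y' , i) =
  Edge G x' y' × ¬ InH H x' y' × OnPath H x y' x' ×
  (∀ u v → InHᵢ H i x x' y' u v → Edge G u v)

module Submission where

-- We take ε₀ = 1/1000, μ₀ = 1 and n₀ = 1500.  As the only A–B edges
-- are those of Z, both ends of e lie in one class S ∈ {A, B}, and (A1)–(A5) make S a
-- dense class: |S| ≤ 1001n/2000, every vertex of S has ≥ 249n/1000 neighbours in S,
-- all but n/1000 of them have ≥ 499n/1000, and only two vertices of S see outside S.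
-- Number the cycle from x.  For a neighbour w₁ of x and a neighbour w₂ of π(x), both
-- away from e, take e' = π⁻¹(w₁)π(w₂) and s₁ if w₁ comes first on the cycle, and
-- e' = π⁻¹(w₂)π(w₁) and s₂ otherwise: the new cycle uses only e', x w₁ and π(x) w₂
-- besides edges of H, so the switching is admissible when e' ∈ G, and distinct pairs
-- give distinct switchings.  Call w usable if its cycle-neighbours lie in S and have
-- high degree.  Then x and π(x) have ≥ n/5 usable neighbours, and for usable w₁ all
-- but 3n/1000 of the usable w₂ give e' ∈ G, since a vertex of high degree misses few
-- vertices of S.  Hence there are ≥ (n/5)(n/6) ≥ n²/300 admissible switchings.

module Counting where
  open import Defs using (count)
  open import Data.Nat using (ℕ; suc; _+_; _*_; _≤_; z≤n; s≤s)
  open import Data.Nat.Properties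
    using (≤-trans; ≤-reflexive; m≤n⇒m≤1+n; n≤1+n; m≤n+m; +-suc; +-monoʳ-≤; +-mono-≤; *-distribˡ-+)
  open import Data.Bool using (Bool; true; false; _∧_; _∨_; not)
  open import Data.Bool.Properties using () renaming (_≟_ to _≟ᵇ_)
  open import Data.Fin using (Fin)
  open import Data.Fin.Properties using (_≟_)
  open import Data.List using (List; []; _∷_; length; filter; map; _++_; allFin; cartesianProduct)
  open import Data.List.Properties using (filter-notAll; length-map; length-tabulate)
  open import Data.List.Membership.Propositional using (_∈_)
  open import Data.List.Membership.Propositional.Properties using (∈-filter⁺; ∈-filter⁻; ∈-allFin; ∈-map⁻)
  open import Data.List.Relation.Unary.Any using (here; there)
  import Data.List.Relation.Unary.Any as Any
  import Data.List.Relation.Unary.All as All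
  open import Data.List.Relation.Unary.AllPairs using (_∷_)
  open import Data.List.Relation.Unary.Unique.Propositional using (Unique)
  import Data.List.Relation.Unary.Unique.Propositional.Properties as Unique
  open import Data.Product using (_×_; _,_; proj₂)
  open import Relation.Binary.Definitions using (DecidableEquality)
  open import Relation.Binary.PropositionalEquality using (_≡_; _≢_; refl; sym; trans; cong; subst)
  open import Relation.Nullary using (¬?; yes; no)
  open import Relation.Nullary.Decidable using (⌊_⌋)

  -- number of entries of a list satisfying P; Defs' `count P` is `countL P (allFin n)`
  countL : {A : Set} → (A → Bool) → List A → ℕ
  countL P xs = length (filter (λ a → P a ≟ᵇ true) xs)

  countL-mono : {A : Set} (P Q : A → Bool) → (∀ a → P a ≡ true → Q a ≡ true) →
    ∀ xs → countL P xs ≤ countL Q xs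
  countL-mono P Q P⇒Q [] = z≤n
  countL-mono P Q P⇒Q (a ∷ xs) with P a in Pa | Q a in Qa
  ... | true  | true  = s≤s (countL-mono P Q P⇒Q xs)
  ... | true  | false with () ← trans (sym (P⇒Q a Pa)) Qa
  ... | false | true  = m≤n⇒m≤1+n (countL-mono P Q P⇒Q xs)
  ... | false | false = countL-mono P Q P⇒Q xs

  countL-∨ : {A : Set} (P Q : A → Bool) → ∀ xs → countL (λ a → P a ∨ Q a) xs ≤ countL P xs + countL Q xs
  countL-∨ P Q [] = z≤n
  countL-∨ P Q (a ∷ xs) with P a | Q a
  ... | true  | true  = s≤s (≤-trans (countL-∨ P Q xs) (+-monoʳ-≤ (countL P xs) (n≤1+n _)))
  ... | true  | false = s≤s (countL-∨ P Q xs)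
  ... | false | true  = ≤-trans (s≤s (countL-∨ P Q xs)) (≤-reflexive (sym (+-suc (countL P xs) (countL Q xs))))
  ... | false | false = countL-∨ P Q xs

  countL-split : {A : Set} (P Q : A → Bool) → ∀ xs →
    countL P xs ≡ countL (λ a → Q a ∧ P a) xs + countL (λ a → not (Q a) ∧ P a) xs
  countL-split P Q [] = refl
  countL-split P Q (a ∷ xs) with P a | Q a
  ... | true  | true  = cong suc (countL-split P Q xs)
  ... | true  | false = trans (cong suc (countL-split P Q xs)) (sym (+-suc _ _))
  ... | false | true  = countL-split P Q xs
  ... | false | false = countL-split P Q xs

  countL-complement : {A : Set} (P : A → Bool) → ∀ xs → countL P xs + countL (λ a → not (P a)) xs ≡ length xs
  countL-complement P [] = refl
  countL-complement P (a ∷ xs) with P a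
  ... | true  = cong suc (countL-complement P xs)
  ... | false = trans (+-suc _ _) (cong suc (countL-complement P xs))

  countL-row : {A B : Set} (R : A × B → Bool) (a : A) → ∀ ys zs →
    countL R (map (a ,_) ys ++ zs) ≡ countL (λ b → R (a , b)) ys + countL R zs
  countL-row R a [] zs = refl
  countL-row R a (b ∷ ys) zs with R (a , b)
  ... | true  = cong suc (countL-row R a ys zs)
  ... | false = countL-row R a ys zs

  countL-product : {A B : Set} (P : A → Bool) (R : A × B → Bool) (k d : ℕ) → ∀ xs ys →
    (∀ a → P a ≡ true → k ≤ d * countL (λ b → R (a , b)) ys) →
    countL P xs * k ≤ d * countL R (cartesianProduct xs ys)
  countL-product P R k d [] ys rows = z≤n
  countL-product P R k d (a ∷ xs) ys rows = begin
      countL P (a ∷ xs) * k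
    ≤⟨ first-row ⟩
      d * countL (λ b → R (a , b)) ys + d * countL R (cartesianProduct xs ys)
    ≡⟨ sym (*-distribˡ-+ d _ _) ⟩
      d * (countL (λ b → R (a , b)) ys + countL R (cartesianProduct xs ys))
    ≡⟨ cong (d *_) (sym (countL-row R a ys (cartesianProduct xs ys))) ⟩
      d * countL R (cartesianProduct (a ∷ xs) ys) ∎
    where
    open Data.Nat.Properties.≤-Reasoning
    rest : countL P xs * k ≤ d * countL R (cartesianProduct xs ys)
    rest = countL-product P R k d xs ys rows
    first-row : countL P (a ∷ xs) * k ≤ d * countL (λ b → R (a , b)) ys + d * countL R (cartesianProduct xs ys)
    first-row with P a in Pa
    ... | true  = +-mono-≤ (rows a Pa) rest
    ... | false = ≤-trans rest (m≤n+m _ _)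

  unique-length : {A : Set} → DecidableEquality A → (xs ys : List A) →
    Unique xs → (∀ {z} → z ∈ xs → z ∈ ys) → length xs ≤ length ys
  unique-length _≟A_ [] ys _ _ = z≤n
  unique-length _≟A_ (x ∷ xs) ys (x∉xs ∷ unique) xs⊆ys =
    ≤-trans (s≤s (unique-length _≟A_ xs others unique xs⊆others))
            (filter-notAll (λ z → ¬? (x ≟A z)) ys (Any.map (λ x≡z x≢z → x≢z x≡z) (xs⊆ys (here refl))))
    where
    others : List _
    others = filter (λ z → ¬? (x ≟A z)) ys
    xs⊆others : ∀ {z} → z ∈ xs → z ∈ others
    xs⊆others z∈xs = ∈-filter⁺ (λ z → ¬? (x ≟A z)) (xs⊆ys (there z∈xs)) (All.lookup x∉xs z∈xs)

  count-complement : ∀ {n} (P : Fin n → Bool) → count P + count (λ u → not (P u)) ≡ n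
  count-complement {n} P = trans (countL-complement P (allFin n)) (length-tabulate (λ i → i))

  infixr 5 _∪_
  _∪_ : {A : Set} → (A → Bool) → (A → Bool) → A → Bool
  (P ∪ Q) a = P a ∨ Q a

  count-∪ : ∀ {n} (P Q : Fin n → Bool) {a b} → count P ≤ a → count Q ≤ b → count (P ∪ Q) ≤ a + b
  count-∪ {n} P Q hP hQ = ≤-trans (countL-∨ P Q (allFin n)) (+-mono-≤ hP hQ)

  count-preimage : ∀ {n} (P : Fin n → Bool) (f : Fin n → Fin n) → (∀ {a b} → f a ≡ f b → a ≡ b) →
    count (λ u → P (f u)) ≤ count P
  count-preimage {n} P f f-inj =
    subst (_≤ count P) (length-map f preimage)
      (unique-length _≟_ (map f preimage) (filter (λ v → P v ≟ᵇ true) (allFin n))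
        (Unique.map⁺ f-inj (Unique.filter⁺ _ (Unique.allFin⁺ n))) image⊆)
    where
    preimage : List (Fin n)
    preimage = filter (λ v → P (f v) ≟ᵇ true) (allFin n)
    image⊆ : ∀ {z} → z ∈ map f preimage → z ∈ filter (λ v → P v ≟ᵇ true) (allFin n)
    image⊆ z∈ with ∈-map⁻ f z∈
    ... | w , w∈ , refl =
      ∈-filter⁺ (λ v → P v ≟ᵇ true) (∈-allFin (f w)) (proj₂ (∈-filter⁻ (λ v → P (f v) ≟ᵇ true) {xs = allFin n} w∈))

  at : ∀ {n} → Fin n → Fin n → Bool
  at a u = ⌊ u ≟ a ⌋

  at-false : ∀ {n} {u a : Fin n} → at a u ≡ false → u ≢ a
  at-false {u = u} {a} u≠a u≡a with u ≟ a
  at-false () u≡a | yes _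
  ... | no u≢a = u≢a u≡a

  count-singleton : ∀ {n} (a : Fin n) → count (at a) ≤ 1
  count-singleton {n} a = unique-length _≟_ equal (a ∷ []) (Unique.filter⁺ _ (Unique.allFin⁺ n)) only-a
    where
    equal : List (Fin n)
    equal = filter (λ v → ⌊ v ≟ a ⌋ ≟ᵇ true) (allFin n)
    only-a : ∀ {z} → z ∈ equal → z ∈ a ∷ []
    only-a {z} z∈ with z ≟ a | proj₂ (∈-filter⁻ (λ v → ⌊ v ≟ a ⌋ ≟ᵇ true) {xs = allFin n} z∈)
    ... | yes refl | _ = here refl
    ... | no _     | ()

-- The natural-number inequalities behind the counting, in the scaled form in which
-- the hypotheses arrive (constants come from ε ≤ 1/1000 and n ≥ 1500).
module Arithmetic where
  open import Data.Nat using (_+_; _*_; _≤_)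
  open import Data.Nat.Properties
    using (≤-trans; m≤m+n; +-monoʳ-≤; +-mono-≤; *-monoʳ-≤; *-monoˡ-≤; +-cancelʳ-≤; *-cancelˡ-≤; module ≤-Reasoning)
  open import Data.Nat.Tactic.RingSolver using (solve-∀)
  open import Relation.Binary.PropositionalEquality using (_≡_; cong)
  open ≤-Reasoning

  few-non-neighbours : ∀ {d r s n} → d + r ≡ s → 2000 * s ≤ 1001 * n → 499 * n ≤ 1000 * d → 2000 * r ≤ 3 * n
  few-non-neighbours {d} {r} {s} {n} split size degree = +-cancelʳ-≤ (998 * n) (2000 * r) (3 * n) (begin
      2000 * r + 998 * n       ≡⟨ cong (2000 * r +_) (scale n) ⟩
      2000 * r + 2 * (499 * n) ≤⟨ +-monoʳ-≤ (2000 * r) (*-monoʳ-≤ 2 degree) ⟩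
      2000 * r + 2 * (1000 * d) ≡⟨ collect r d ⟩
      2000 * (d + r)            ≡⟨ cong (2000 *_) split ⟩
      2000 * s                  ≤⟨ size ⟩
      1001 * n                  ≡⟨ separate n ⟩
      3 * n + 998 * n           ∎)
    where
    scale : ∀ n → 998 * n ≡ 2 * (499 * n)
    scale = solve-∀
    collect : ∀ r d → 2000 * r + 2 * (1000 * d) ≡ 2000 * (d + r)
    collect = solve-∀
    separate : ∀ n → 1001 * n ≡ 3 * n + 998 * n
    separate = solve-∀

  many-remain : ∀ {d c b l n} → 249 * n ≤ 1000 * d → d ≤ c + b → b ≤ 6 + 2 * l → 1000 * l ≤ n → 1500 ≤ n →
    n ≤ 5 * c
  many-remain {d} {c} {b} {l} {n} degree split bad low large = *-cancelˡ-≤ 1000 (begin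
      1000 * n         ≤⟨ m≤m+n (1000 * n) (215 * n) ⟩
      1000 * n + 215 * n ≡⟨ regroup n ⟩
      5 * (243 * n)    ≤⟨ *-monoʳ-≤ 5 remaining ⟩
      5 * (1000 * c)   ≡⟨ reorder c ⟩
      1000 * (5 * c)   ∎)
    where
    regroup : ∀ n → 1000 * n + 215 * n ≡ 5 * (243 * n)
    regroup = solve-∀
    reorder : ∀ c → 5 * (1000 * c) ≡ 1000 * (5 * c)
    reorder = solve-∀
    expand : ∀ c l → 1000 * (c + (6 + 2 * l)) ≡ 1000 * c + 4 * 1500 + 2 * (1000 * l)
    expand = solve-∀
    split6 : ∀ n → 243 * n + 6 * n ≡ 249 * n
    split6 = solve-∀
    collect : ∀ c n → 1000 * c + 4 * n + 2 * n ≡ 1000 * c + 6 * n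
    collect = solve-∀
    remaining : 243 * n ≤ 1000 * c
    remaining = +-cancelʳ-≤ (6 * n) (243 * n) (1000 * c) (begin
      243 * n + 6 * n                            ≡⟨ split6 n ⟩
      249 * n                                    ≤⟨ degree ⟩
      1000 * d                                   ≤⟨ *-monoʳ-≤ 1000 (≤-trans split (+-monoʳ-≤ c bad)) ⟩
      1000 * (c + (6 + 2 * l))                   ≡⟨ expand c l ⟩
      1000 * c + 4 * 1500 + 2 * (1000 * l)       ≤⟨ +-mono-≤ (+-monoʳ-≤ (1000 * c) (*-monoʳ-≤ 4 large)) (*-monoʳ-≤ 2 low) ⟩
      1000 * c + 4 * n + 2 * n                   ≡⟨ collect c n ⟩
      1000 * c + 6 * n                           ∎)

  row-remains : ∀ {c g r₁ r₂ n} → c ≤ g + (r₁ + r₂) → n ≤ 5 * c → 2000 * r₁ ≤ 3 * n → 2000 * r₂ ≤ 3 * n →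
    n ≤ 6 * g
  row-remains {c} {g} {r₁} {r₂} {n} cover many few₁ few₂ = *-cancelˡ-≤ 10000 (begin
      10000 * n                ≤⟨ m≤m+n (10000 * n) (1820 * n) ⟩
      10000 * n + 1820 * n     ≡⟨ regroup n ⟩
      6 * (1970 * n)           ≤⟨ *-monoʳ-≤ 6 remaining ⟩
      6 * (10000 * g)          ≡⟨ reorder g ⟩
      10000 * (6 * g)          ∎)
    where
    regroup : ∀ n → 10000 * n + 1820 * n ≡ 6 * (1970 * n)
    regroup = solve-∀
    reorder : ∀ g → 6 * (10000 * g) ≡ 10000 * (6 * g)
    reorder = solve-∀
    expand : ∀ n → 1970 * n + 30 * n ≡ 2000 * n
    expand = solve-∀
    distribute : ∀ g r₁ r₂ → 10000 * (g + (r₁ + r₂)) ≡ 10000 * g + (5 * (2000 * r₁) + 5 * (2000 * r₂))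
    distribute = solve-∀
    collect : ∀ g n → 10000 * g + (5 * (3 * n) + 5 * (3 * n)) ≡ 10000 * g + 30 * n
    collect = solve-∀
    remaining : 1970 * n ≤ 10000 * g
    remaining = +-cancelʳ-≤ (30 * n) (1970 * n) (10000 * g) (begin
      1970 * n + 30 * n        ≡⟨ expand n ⟩
      2000 * n                 ≤⟨ *-monoʳ-≤ 2000 many ⟩
      2000 * (5 * c)           ≡⟨ scale c ⟩
      10000 * c                ≤⟨ *-monoʳ-≤ 10000 cover ⟩
      10000 * (g + (r₁ + r₂))  ≡⟨ distribute g r₁ r₂ ⟩
      10000 * g + (5 * (2000 * r₁) + 5 * (2000 * r₂))
                               ≤⟨ +-monoʳ-≤ (10000 * g) (+-mono-≤ (*-monoʳ-≤ 5 few₁) (*-monoʳ-≤ 5 few₂)) ⟩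
      10000 * g + (5 * (3 * n) + 5 * (3 * n))
                               ≡⟨ collect g n ⟩
      10000 * g + 30 * n       ∎)
      where
      scale : ∀ c → 2000 * (5 * c) ≡ 10000 * c
      scale = solve-∀

  square-bound : ∀ {c L n} → c * n ≤ 6 * L → n ≤ 5 * c → n * n ≤ 300 * L
  square-bound {c} {L} {n} rows many = begin
      n * n         ≤⟨ *-monoˡ-≤ n many ⟩
      5 * c * n     ≡⟨ assoc c n ⟩
      5 * (c * n)   ≤⟨ *-monoʳ-≤ 5 rows ⟩
      5 * (6 * L)   ≤⟨ m≤m+n (5 * (6 * L)) (270 * L) ⟩
      5 * (6 * L) + 270 * L ≡⟨ total L ⟩
      300 * L       ∎
    where
    assoc : ∀ c n → 5 * c * n ≡ 5 * (c * n)
    assoc = solve-∀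
    total : ∀ L → 5 * (6 * L) + 270 * L ≡ 300 * L
    total = solve-∀

  majority-bound : ∀ {a b n} → a + b ≡ n → 1000 * a ≤ 1000 * b + n → 2000 * a ≤ 1001 * n
  majority-bound {a} {b} {n} total close = begin
      2000 * a                    ≡⟨ double a ⟩
      1000 * a + 1000 * a         ≤⟨ +-monoʳ-≤ (1000 * a) close ⟩
      1000 * a + (1000 * b + n)   ≡⟨ regroup a b n ⟩
      1000 * (a + b) + n          ≡⟨ cong (λ m → 1000 * m + n) total ⟩
      1000 * n + n                ≡⟨ collect n ⟩
      1001 * n                    ∎
    where
    double : ∀ a → 2000 * a ≡ 1000 * a + 1000 * a
    double = solve-∀
    regroup : ∀ a b n → 1000 * a + (1000 * b + n) ≡ 1000 * (a + b) + n
    regroup = solve-∀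
    collect : ∀ n → 1000 * n + n ≡ 1001 * n
    collect = solve-∀

-- Positions along a directed Hamilton cycle, and where the chords of a switching lie.
module Cycles where
  open import Defs hiding (sym)
  open import Data.Nat using (ℕ; zero; suc; _+_; _∸_; _≤_; _<_; z≤n; s≤s; _<?_)
  open import Data.Nat.Properties
    using (≤-trans; <-trans; <-≤-trans; ≤-pred; n≤1+n; m≤n+m; +-suc; +-monoˡ-≤; m∸n+n≡m; ≤∧≮⇒≡; ≤∧≢⇒<; m≤n⇒m<n∨m≡n; m≤n⇒∃[o]m+o≡n)
  open import Data.Fin using (Fin)
  open import Data.Fin.Properties using (_≟_)
  open import Data.Fin.Permutation using (inverseˡ; inverseʳ)
  open import Data.Product using (∃; _×_; _,_; proj₁; proj₂)
  open import Data.Sum using (inj₁; inj₂)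
  open import Data.Empty using (⊥-elim)
  open import Relation.Binary.PropositionalEquality
  open import Relation.Nullary using (¬_; yes; no)
  open import Level using (0ℓ)
  open import Relation.Unary using (Pred; Decidable)

  iter-+ : {A : Set} (f : A → A) → ∀ j m y → iter f (j + m) y ≡ iter f j (iter f m y)
  iter-+ f zero    m y = refl
  iter-+ f (suc j) m y = cong f (iter-+ f j m y)

  iter-comm : {A : Set} (f : A → A) → ∀ k y → iter f k (f y) ≡ f (iter f k y)
  iter-comm f zero    y = refl
  iter-comm f (suc k) y = cong f (iter-comm f k y)

  iter-injective : {A : Set} (f : A → A) → (∀ {a b} → f a ≡ f b → a ≡ b) →
    ∀ k {a b} → iter f k a ≡ iter f k b → a ≡ b
  iter-injective f f-inj zero    e = e
  iter-injective f f-inj (suc k) e = iter-injective f f-inj k (f-inj e)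

  least-witness : (P : Pred ℕ 0ℓ) → Decidable P → ∀ k → P k → ∃ λ m → P m × (∀ j → j < m → ¬ P j)
  least-witness P P? zero    Pk = zero , Pk , λ _ ()
  least-witness P P? (suc k) Pk with P? zero | least-witness (λ j → P (suc j)) (λ j → P? (suc j)) k Pk
  ... | yes P0 | _ = zero , P0 , λ _ ()
  ... | no ¬P0 | m , Pm , below = suc m , Pm , earlier
    where
    earlier : ∀ j → j < suc m → ¬ P j
    earlier zero    _         = ¬P0
    earlier (suc j) (s≤s j<m) = below j j<m

  -- Number the cycle from x: v k is the vertex k steps after x; p is the length of the cycle
  module Positions {n} {G : Graph n} (H : DirHamCycle G) (x : Fin n) where
    s pr : Fin n → Fin n
    s  = succ H
    pr = pred H

    pred-succ : ∀ y → pr (s y) ≡ y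
    pred-succ y = inverseˡ (π H)

    succ-pred : ∀ y → s (pr y) ≡ y
    succ-pred y = inverseʳ (π H)

    succ-injective : ∀ {a b} → s a ≡ s b → a ≡ b
    succ-injective {a} {b} e = trans (sym (pred-succ a)) (trans (cong pr e) (pred-succ b))

    pred-injective : ∀ {a b} → pr a ≡ pr b → a ≡ b
    pred-injective {a} {b} e = trans (sym (succ-pred a)) (trans (cong s e) (succ-pred b))

    pred-of : ∀ {w y} → s w ≡ y → w ≡ pr y
    pred-of {w} e = trans (sym (pred-succ w)) (cong pr e)

    v : ℕ → Fin n
    v k = iter s k x

    first-return : ∃ λ m → v (suc m) ≡ x × (∀ j → j < m → v (suc j) ≢ x)
    first-return = least-witness (λ j → v (suc j) ≡ x) (λ j → v (suc j) ≟ x) k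
                     (trans (sym (iter-comm s k x)) returns)
      where
      k : ℕ
      k = proj₁ (oneCycle H (s x) x)
      returns : iter s k (s x) ≡ x
      returns = proj₂ (oneCycle H (s x) x)

    p : ℕ
    p = suc (proj₁ first-return)

    v-period : v p ≡ x
    v-period = proj₁ (proj₂ first-return)

    v-aperiodic : ∀ j → suc j < p → v (suc j) ≢ x
    v-aperiodic j j+1<p = proj₂ (proj₂ first-return) j (≤-pred j+1<p)

    v-distinct : ∀ i j → i < j → j < p → v i ≢ v j
    v-distinct i j i<j j<p vi≡vj with m≤n⇒∃[o]m+o≡n i<j
    ... | d , refl = v-aperiodic d (<-≤-trans (s≤s (s≤s (m≤n+m d i))) j<p) (sym returns-to-x)
      where
      returns-to-x : x ≡ v (suc d)
      returns-to-x = iter-injective s succ-injective i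
        (trans vi≡vj (trans (cong v (sym (+-suc i d))) (iter-+ s i (suc d) x)))

    reduce : ∀ k → ∃ λ r → r < p × v r ≡ v k
    reduce zero = zero , s≤s z≤n , refl
    reduce (suc k) with reduce k
    ... | r , r<p , vr≡vk with suc r <? p
    ...   | yes r+1<p = suc r , r+1<p , cong s vr≡vk
    ...   | no  r+1≮p = zero , s≤s z≤n ,
              trans (sym v-period) (trans (cong v (sym (≤∧≮⇒≡ r<p r+1≮p))) (cong s vr≡vk))

    pos : Fin n → ℕ
    pos w = proj₁ (reduce (proj₁ (oneCycle H x w)))

    pos-bound : ∀ w → pos w < p
    pos-bound w = proj₁ (proj₂ (reduce (proj₁ (oneCycle H x w))))

    v-pos : ∀ w → v (pos w) ≡ w
    v-pos w = trans (proj₂ (proj₂ (reduce (proj₁ (oneCycle H x w))))) (proj₂ (oneCycle H x w))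

    Inner : Fin n → Set
    Inner w = ∃ λ i → pos w ≡ 2 + i × 5 + i ≤ p

    inner : ∀ w → w ≢ x → w ≢ s x → w ≢ pr x → w ≢ pr (pr x) → Inner w
    inner w w≢x w≢sx w≢px w≢ppx = proj₁ after-x , proj₂ after-x , subst (λ k → 3 + k ≤ p) (proj₂ after-x) room
      where
      at-least-two : ∀ k → v k ≡ w → ∃ λ i → k ≡ 2 + i
      at-least-two zero          e = ⊥-elim (w≢x (sym e))
      at-least-two (suc zero)    e = ⊥-elim (w≢sx (sym e))
      at-least-two (suc (suc i)) e = i , refl
      after-x : ∃ λ i → pos w ≡ 2 + i
      after-x = at-least-two (pos w) (v-pos w)
      not-last : suc (pos w) ≢ p
      not-last e = w≢px (pred-of (trans (cong s (sym (v-pos w))) (trans (cong v e) v-period)))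
      not-second-last : 2 + pos w ≢ p
      not-second-last e = w≢ppx (pred-of (pred-of
        (trans (cong (λ y → s (s y)) (sym (v-pos w))) (trans (cong v e) v-period))))
      room : 3 + pos w ≤ p
      room = ≤∧≢⇒< (≤∧≢⇒< (pos-bound w) not-last) not-second-last

    chord : ∀ i j → 1 ≤ i → 2 + i ≤ j → 2 + j ≤ p → ¬ InH H (v i) (v j) × OnPath H x (v j) (v i)
    chord i j 1≤i i+2≤j j+2≤p = not-edge , (p ∸ j , reaches-x , avoids-vi)
      where
      i<j : i < j
      i<j = ≤-trans (n≤1+n (suc i)) i+2≤j
      j<p : j < p
      j<p = ≤-trans (n≤1+n (suc j)) j+2≤p
      not-edge : ¬ InH H (v i) (v j)
      not-edge (inj₁ e) = v-distinct (suc i) j i+2≤j j<p e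
      not-edge (inj₂ e) = v-distinct i (suc j) (s≤s (≤-trans (n≤1+n i) i<j)) j+2≤p (sym e)
      steps : ∀ t → iter s t (v j) ≡ v (t + j)
      steps t = sym (iter-+ s t j x)
      reaches-x : iter s (p ∸ j) (v j) ≡ x
      reaches-x = trans (steps (p ∸ j)) (trans (cong v (m∸n+n≡m (≤-trans (n≤1+n j) j<p))) v-period)
      avoids-vi : ∀ t → t ≤ p ∸ j → iter s t (v j) ≢ v i
      avoids-vi t t≤ e with m≤n⇒m<n∨m≡n (subst (t + j ≤_) (m∸n+n≡m (≤-trans (n≤1+n j) j<p)) (+-monoˡ-≤ j t≤))
      ... | inj₁ t+j<p = v-distinct i (t + j) (<-≤-trans i<j (m≤n+m j t)) t+j<p (sym (trans (sym (steps t)) e))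
      ... | inj₂ t+j≡p = v-distinct 0 i 1≤i (<-trans i<j j<p)
              (trans (sym v-period) (trans (cong v (sym t+j≡p)) (trans (sym (steps t)) e)))

    switch-chord : ∀ {w w'} → Inner w → Inner w' → pos w ≤ pos w' →
      ¬ InH H (pr w) (s w') × OnPath H x (s w') (pr w)
    switch-chord {w} {w'} (i , pos-w , _) (i' , pos-w' , room') w≤w' =
      subst₂ (λ a b → ¬ InH H a b × OnPath H x b a) (sym pr-w) (sym s-w')
        (chord (1 + i) (3 + i') (s≤s z≤n) (s≤s (subst₂ _≤_ pos-w pos-w' w≤w')) room')
      where
      pr-w : pr w ≡ v (1 + i)
      pr-w = trans (cong pr (trans (sym (v-pos w)) (cong v pos-w))) (pred-succ (v (1 + i)))
      s-w' : s w' ≡ v (3 + i')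
      s-w' = cong s (trans (sym (v-pos w')) (cong v pos-w'))

-- The switchings of Lemma 18 inside one dense class S of the partition.
module Switchings where
  open import Defs hiding (sym)
  open Counting
  open Arithmetic
  open Cycles
  open import Data.Nat using (_+_; _*_; _≤_; _≤?_)
  open import Data.Nat.Properties using (≤-refl; ≤-trans; *-monoʳ-≤; +-identityʳ; ≰⇒≥)
  open import Data.Bool using (Bool; true; false; _∧_; _∨_; not)
  open import Data.Bool.Properties using (∨-zeroʳ) renaming (_≟_ to _≟ᵇ_)
  open import Data.Fin using (Fin)
  open import Data.List using (List; filter; map; length; allFin; cartesianProduct)
  open import Data.List.Properties using (length-map)
  open import Data.List.Relation.Unary.All using (All)
  import Data.List.Relation.Unary.All as All
  import Data.List.Relation.Unary.All.Properties as All
  open import Data.List.Relation.Unary.Unique.Propositional using (Unique)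
  import Data.List.Relation.Unary.Unique.Propositional.Properties as Unique
  open import Data.Product using (∃; _×_; _,_; proj₁; proj₂)
  open import Data.Sum using (_⊎_; inj₁; inj₂; [_,_])
  open import Data.Empty using (⊥-elim)
  open import Function using (_∘_)
  open import Relation.Binary.PropositionalEquality hiding ([_])
  open import Relation.Nullary using (¬_; yes; no)

  ManySwitchings : ∀ {n} {G : Graph n} → DirHamCycle G → Fin n → Set
  ManySwitchings {n} H x = ∃ λ (L : List (Fin n × Fin n × SwitchIndex)) →
    Unique L × All (Admissible H x) L × n * n ≤ 300 * length L

  -- The numerical content of (A1)–(A5) for one class S, with ε ≤ 1/1000: S has at most
  -- 1001n/2000 vertices, each of degree ≥ 249n/1000 in S; all but n/1000 of them are
  -- `high` (degree ≥ 499n/1000 in S); only two vertices of S have neighbours outside S.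
  record DenseClass {n} (G : Graph n) (S : Fin n → Bool) : Set where
    field
      high         : Fin n → Bool
      exit₁ exit₂  : Fin n
      exits        : ∀ u w → S u ≡ true → S w ≡ false → Edge G u w → u ≡ exit₁ ⊎ u ≡ exit₂
      size         : 2000 * count S ≤ 1001 * n
      few-low      : 1000 * count (λ u → S u ∧ not (high u)) ≤ n
      min-degree   : ∀ u → S u ≡ true → 249 * n ≤ 1000 * deg G u S
      high-degree  : ∀ u → S u ≡ true → high u ≡ true → 499 * n ≤ 1000 * deg G u S

  edge-sym : ∀ {n} (G : Graph n) {a b} → Edge G a b → Edge G b a
  edge-sym G {a} {b} e = trans (Graph.sym G b a) e

  pair-edge : ∀ {n} (G : Graph n) {a b u w} → SamePair a b u w → Edge G u w → Edge G a b
  pair-edge G (inj₁ (refl , refl)) e = e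
  pair-edge G (inj₂ (refl , refl)) e = edge-sym G e

  added-edges-suffice : ∀ {n} {G : Graph n} (H : DirHamCycle G) i x x' y' →
    (∀ a b → Added H i x x' y' a b → Edge G a b) → ∀ a b → InHᵢ H i x x' y' a b → Edge G a b
  added-edges-suffice H i x x' y' added a b (inj₁ (inj₁ refl , _)) = edges H a
  added-edges-suffice {G = G} H i x x' y' added a b (inj₁ (inj₂ refl , _)) = edge-sym G (edges H b)
  added-edges-suffice H i x x' y' added a b (inj₂ new) = added a b new

  ∧-true : ∀ {a b} → a ∧ b ≡ true → a ≡ true × b ≡ true
  ∧-true {true} e = refl , e

  ∨-false : ∀ {a b} → a ∨ b ≡ false → a ≡ false × b ≡ false
  ∨-false {false} e = refl , e

  not-true : ∀ {a} → not a ≡ true → a ≡ false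
  not-true {false} _ = refl

  not-false : ∀ {a} → not a ≡ false → a ≡ true
  not-false {true} _ = refl

  module Core {n} {G : Graph n} {S : Fin n → Bool} (D : DenseClass G S) (H : DirHamCycle G) (x : Fin n) where
    open DenseClass D
    open Positions H x

    low : Fin n → Bool
    low u = S u ∧ not (high u)

    Heavy : Fin n → Set
    Heavy u = S u ≡ true × high u ≡ true

    -- the vertices that are too close to e for a chord through their cycle-neighbours
    near : Fin n → Bool
    near = at x ∪ at (s x) ∪ at (pr x) ∪ at (pr (pr x))

    bad : Fin n → Bool
    bad = near ∪ at exit₁ ∪ at exit₂ ∪ low ∘ pr ∪ low ∘ s

    usable : Fin n → Fin n → Bool
    usable y w = (adj G y w ∧ S w) ∧ not (bad w)

    record Usable (y w : Fin n) : Set where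
      field
        adjacent   : Edge G y w
        interior   : Inner w
        pred-heavy : Heavy (pr w)
        succ-heavy : Heavy (s w)
    open Usable

    stays-in-S : ∀ {w u} → S w ≡ true → w ≢ exit₁ → w ≢ exit₂ → Edge G w u → S u ≡ true
    stays-in-S {w} {u} Sw ≢exit₁ ≢exit₂ e with S u in Su
    ... | true  = refl
    ... | false = ⊥-elim ([ ≢exit₁ , ≢exit₂ ] (exits w u Sw Su e))

    heavy : ∀ {u} → S u ≡ true → low u ≡ false → Heavy u
    heavy Su not-low rewrite Su = refl , not-false not-low

    not-bad : ∀ {w} → bad w ≡ false →
      Inner w × w ≢ exit₁ × w ≢ exit₂ × low (pr w) ≡ false × low (s w) ≡ false
    not-bad {w} b with ∨-false b
    ... | not-near , others with ∨-false not-near | ∨-false others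
    ...   | ≢x , near₁ | ≢exit₁ , others₁ with ∨-false near₁ | ∨-false others₁
    ...     | ≢sx , near₂ | ≢exit₂ , lows with ∨-false near₂ | ∨-false lows
    ...       | ≢px , ≢ppx | low-pred , low-succ =
      inner w (at-false ≢x) (at-false ≢sx) (at-false ≢px) (at-false ≢ppx) ,
      at-false ≢exit₁ , at-false ≢exit₂ , low-pred , low-succ

    usable-sound : ∀ y w → usable y w ≡ true → Usable y w
    usable-sound y w u with ∧-true u
    ... | yw∧Sw , ¬bad with ∧-true yw∧Sw | not-bad (not-true ¬bad)
    ...   | yw , Sw | interior-w , ≢exit₁ , ≢exit₂ , low-pred , low-succ = record
      { adjacent   = yw
      ; interior   = interior-w
      ; pred-heavy = heavy S-pred low-pred
      ; succ-heavy = heavy S-succ low-succ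
      }
      where
      S-pred : S (pr w) ≡ true
      S-pred = stays-in-S Sw ≢exit₁ ≢exit₂ (edge-sym G (subst (Edge G (pr w)) (succ-pred w) (edges H (pr w))))
      S-succ : S (s w) ≡ true
      S-succ = stays-in-S Sw ≢exit₁ ≢exit₂ (edges H w)

    deg-split : ∀ y → deg G y S ≤ count (usable y) + count bad
    deg-split y = ≤-trans (countL-mono _ (λ w → usable y w ∨ bad w) covered (allFin n))
                          (countL-∨ (usable y) bad (allFin n))
      where
      covered : ∀ w → adj G y w ∧ S w ≡ true → (adj G y w ∧ S w) ∧ not (bad w) ∨ bad w ≡ true
      covered w yw∧Sw with bad w
      ... | true  = ∨-zeroʳ _
      ... | false rewrite yw∧Sw = refl

    -- four vertices near e, two exits, and the cycle-neighbours of low vertices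
    bad-count : count bad ≤ 6 + 2 * count low
    bad-count = subst (count bad ≤_) (cong (λ c → 6 + (count low + c)) (sym (+-identityʳ (count low))))
      (count-∪ near _ near-count
        (count-∪ (at exit₁) _ (count-singleton exit₁)
          (count-∪ (at exit₂) _ (count-singleton exit₂)
            (count-∪ (low ∘ pr) (low ∘ s) (count-preimage low pr pred-injective) (count-preimage low s succ-injective)))))
      where
      near-count : count near ≤ 4
      near-count = count-∪ (at x) _ (count-singleton x) (count-∪ (at (s x)) _ (count-singleton (s x))
                     (count-∪ (at (pr x)) (at (pr (pr x))) (count-singleton (pr x)) (count-singleton (pr (pr x)))))

    many-usable : 1500 ≤ n → ∀ y → S y ≡ true → n ≤ 5 * count (usable y)
    many-usable large y Sy =
      many-remain {c = count (usable y)} {l = count low} {n = n} (min-degree y Sy) (deg-split y) bad-count few-low large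

    missing : Fin n → Fin n → Bool
    missing a u = not (adj G a u) ∧ S u

    few-missing : ∀ a → Heavy a → 2000 * count (missing a) ≤ 3 * n
    few-missing a (Sa , high-a) =
      few-non-neighbours {d = deg G a S} {r = count (missing a)} {n = n}
        (sym (countL-split S (adj G a) (allFin n))) size (high-degree a Sa high-a)

    switch : Fin n × Fin n → Fin n × Fin n × SwitchIndex
    switch (w₁ , w₂) with pos w₁ ≤? pos w₂
    ... | yes _ = pr w₁ , s w₂ , s₁
    ... | no  _ = pr w₂ , s w₁ , s₂

    switch-injective : ∀ {q q'} → switch q ≡ switch q' → q ≡ q'
    switch-injective {w₁ , w₂} {w₁' , w₂'} e with pos w₁ ≤? pos w₂ | pos w₁' ≤? pos w₂'
    ... | yes _ | yes _ = cong₂ _,_ (pred-injective (cong proj₁ e)) (succ-injective (cong (λ t → proj₁ (proj₂ t)) e))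
    ... | yes _ | no  _ with () ← cong (λ t → proj₂ (proj₂ t)) e
    ... | no  _ | yes _ with () ← cong (λ t → proj₂ (proj₂ t)) e
    ... | no  _ | no  _ = cong₂ _,_ (succ-injective (cong (λ t → proj₁ (proj₂ t)) e)) (pred-injective (cong proj₁ e))

    chord-in-G : Fin n × Fin n → Bool
    chord-in-G q = adj G (proj₁ (switch q)) (proj₁ (proj₂ (switch q)))

    good : Fin n × Fin n → Bool
    good (w₁ , w₂) = usable x w₁ ∧ usable (s x) w₂ ∧ chord-in-G (w₁ , w₂)

    -- the switching adds e', x w₁ and s(x) w₂; the chord lies where switch-chord says
    switch-admissible : ∀ w₁ w₂ → Usable x w₁ → Usable (s x) w₂ → chord-in-G (w₁ , w₂) ≡ true →
      Admissible H x (switch (w₁ , w₂))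
    switch-admissible w₁ w₂ u₁ u₂ e' with pos w₁ ≤? pos w₂
    ... | yes w₁≤w₂ = e' , proj₁ geometry , proj₂ geometry , added-edges-suffice H s₁ x (pr w₁) (s w₂) added
      where
      geometry : ¬ InH H (pr w₁) (s w₂) × OnPath H x (s w₂) (pr w₁)
      geometry = switch-chord (interior u₁) (interior u₂) w₁≤w₂
      added : ∀ a b → Added H s₁ x (pr w₁) (s w₂) a b → Edge G a b
      added a b (inj₁ same) = pair-edge G same e'
      added a b (inj₂ (inj₁ same)) = pair-edge G same (subst (Edge G x) (sym (succ-pred w₁)) (adjacent u₁))
      added a b (inj₂ (inj₂ same)) =
        pair-edge G same (subst (λ w → Edge G w (s x)) (sym (pred-succ w₂)) (edge-sym G (adjacent u₂)))
    ... | no  w₁≰w₂ = e' , proj₁ geometry , proj₂ geometry , added-edges-suffice H s₂ x (pr w₂) (s w₁) added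
      where
      geometry : ¬ InH H (pr w₂) (s w₁) × OnPath H x (s w₁) (pr w₂)
      geometry = switch-chord (interior u₂) (interior u₁) (≰⇒≥ w₁≰w₂)
      added : ∀ a b → Added H s₂ x (pr w₂) (s w₁) a b → Edge G a b
      added a b (inj₁ same) = pair-edge G same e'
      added a b (inj₂ (inj₁ same)) = pair-edge G same (subst (Edge G x) (sym (pred-succ w₁)) (adjacent u₁))
      added a b (inj₂ (inj₂ same)) = pair-edge G same (subst (Edge G (s x)) (sym (succ-pred w₂)) (adjacent u₂))

    good-admissible : ∀ q → good q ≡ true → Admissible H x (switch q)
    good-admissible (w₁ , w₂) g with ∧-true g
    ... | u₁ , rest with ∧-true rest
    ...   | u₂ , e' = switch-admissible w₁ w₂ (usable-sound x w₁ u₁) (usable-sound (s x) w₂ u₂) e'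

    row-cover : ∀ w₁ w₂ → usable x w₁ ≡ true → usable (s x) w₂ ≡ true →
      good (w₁ , w₂) ∨ (missing (pr w₁) (s w₂) ∨ missing (s w₁) (pr w₂)) ≡ true
    row-cover w₁ w₂ u₁ u₂ rewrite u₁ | u₂ with pos w₁ ≤? pos w₂
    ... | yes _ with adj G (pr w₁) (s w₂)
    ...   | true  = refl
    ...   | false rewrite proj₁ (succ-heavy (usable-sound (s x) w₂ u₂)) = refl
    row-cover w₁ w₂ u₁ u₂ | no _ with adj G (pr w₂) (s w₁) in e
    ...   | true  = refl
    ...   | false rewrite Graph.sym G (s w₁) (pr w₂) | e | proj₁ (pred-heavy (usable-sound (s x) w₂ u₂)) = ∨-zeroʳ _

    row-bound : 1500 ≤ n → S (s x) ≡ true → ∀ w₁ → usable x w₁ ≡ true →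
      n ≤ 6 * countL (λ w₂ → good (w₁ , w₂)) (allFin n)
    row-bound large Ssx w₁ u₁ =
      row-remains {c = count (usable (s x))} {g = count along-row}
                  {r₁ = count missing-after} {r₂ = count missing-before} {n = n}
                  cover (many-usable large (s x) Ssx) few-after few-before
      where
      usable₁ : Usable x w₁
      usable₁ = usable-sound x w₁ u₁
      along-row missing-after missing-before : Fin n → Bool
      along-row w₂ = good (w₁ , w₂)
      missing-after w₂ = missing (pr w₁) (s w₂)
      missing-before w₂ = missing (s w₁) (pr w₂)
      cover : count (usable (s x)) ≤ count along-row + (count missing-after + count missing-before)
      cover = ≤-trans (countL-mono (usable (s x)) (along-row ∪ missing-after ∪ missing-before)
                        (λ w₂ u₂ → row-cover w₁ w₂ u₁ u₂) (allFin n))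
                      (count-∪ along-row _ ≤-refl (count-∪ missing-after missing-before ≤-refl ≤-refl))
      few-after : 2000 * count missing-after ≤ 3 * n
      few-after = ≤-trans (*-monoʳ-≤ 2000 (count-preimage (missing (pr w₁)) s succ-injective))
                          (few-missing (pr w₁) (pred-heavy usable₁))
      few-before : 2000 * count missing-before ≤ 3 * n
      few-before = ≤-trans (*-monoʳ-≤ 2000 (count-preimage (missing (s w₁)) pr pred-injective))
                           (few-missing (s w₁) (succ-heavy usable₁))

    many-switchings : 1500 ≤ n → S x ≡ true → S (s x) ≡ true → ManySwitchings H x
    many-switchings large Sx Ssx = map switch good-pairs , distinct , admissible , enough
      where
      pairs good-pairs : List (Fin n × Fin n)
      pairs = cartesianProduct (allFin n) (allFin n)
      good-pairs = filter (λ q → good q ≟ᵇ true) pairs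
      distinct : Unique (map switch good-pairs)
      distinct = Unique.map⁺ switch-injective
        (Unique.filter⁺ _ (Unique.cartesianProduct⁺ (Unique.allFin⁺ n) (Unique.allFin⁺ n)))
      admissible : All (Admissible H x) (map switch good-pairs)
      admissible = All.map⁺ (All.map (λ {q} → good-admissible q) (All.all-filter (λ q → good q ≟ᵇ true) pairs))
      enough : n * n ≤ 300 * length (map switch good-pairs)
      enough = square-bound {c = count (usable x)} {L = length (map switch good-pairs)}
        (subst (λ k → count (usable x) * n ≤ 6 * k) (sym (length-map switch good-pairs))
          (countL-product (usable x) good n 6 (allFin n) (allFin n) (row-bound large Ssx)))
        (many-usable large x Sx)

-- From the rational conditions (A1)–(A5) with ε ≤ ε₀ = 1/1000 to dense classes.
module FromSuperExtremal where
  open import Defs hiding (sym)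
  open Arithmetic using (majority-bound)
  open Switchings using (DenseClass)
  open import Data.Nat as ℕ using (ℕ; suc)
  import Data.Nat.Properties as ℕP
  import Data.Nat.Coprimality as Coprime
  open import Data.Integer as ℤ using (+_)
  import Data.Integer.Properties as ℤP
  open import Data.Bool using (Bool; true; false; T)
  open import Data.Fin using (Fin)
  open import Data.Rational using (ℚ; mkℚ; _/_; _+_; _-_; _*_; _≤_; ½; ∣_∣; NonNegative; toℚᵘ)
  open import Data.Rational.Properties
    using (normalize-coprime; normalize-nonNeg; toℚᵘ-injective; toℚᵘ-homo-+; toℚᵘ-homo-*; toℚᵘ-mono-≤;
           ≤-trans; +-monoʳ-≤; neg-antimono-≤; *-monoʳ-≤-nonNeg; nonNegative⁻¹; 0≤p⇒∣p∣≡p; ∣-p∣≡∣p∣;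
           _≤?_; +-0-abelianGroup)
  open import Data.Rational.Unnormalised as U using (mkℚᵘ; *≡*; *≤*)
  import Data.Rational.Unnormalised.Properties as UP
  open import Algebra.Properties.AbelianGroup +-0-abelianGroup using (xyx⁻¹≈y; ⁻¹-anti-homo‿-)
  open import Data.Product using (_,_)
  open import Data.Sum using (_⊎_; inj₁; inj₂)
  open import Data.Unit using (tt)
  open import Relation.Binary.PropositionalEquality
  open import Relation.Nullary.Decidable using (⌊_⌋; toWitness)

  ε₀ : ℚ
  ε₀ = + 1 / 1000

  ℕ→ℚ-mkℚ : ∀ n → ℕ→ℚ n ≡ mkℚ (+ n) 0 (Coprime.sym (Coprime.1-coprimeTo n))
  ℕ→ℚ-mkℚ n = normalize-coprime (Coprime.sym (Coprime.1-coprimeTo n))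

  toℚᵘ-ℕ→ℚ : ∀ n → toℚᵘ (ℕ→ℚ n) ≡ mkℚᵘ (+ n) 0
  toℚᵘ-ℕ→ℚ n = cong toℚᵘ (ℕ→ℚ-mkℚ n)

  ℕ→ℚ-nonNeg : ∀ n → NonNegative (ℕ→ℚ n)
  ℕ→ℚ-nonNeg n = normalize-nonNeg n 1

  ℕ→ℚ-+ : ∀ m k → ℕ→ℚ (m ℕ.+ k) ≡ ℕ→ℚ m + ℕ→ℚ k
  ℕ→ℚ-+ m k = toℚᵘ-injective (UP.≃-sym (begin
      toℚᵘ (ℕ→ℚ m + ℕ→ℚ k)                ≈⟨ toℚᵘ-homo-+ (ℕ→ℚ m) (ℕ→ℚ k) ⟩
      toℚᵘ (ℕ→ℚ m) U.+ toℚᵘ (ℕ→ℚ k)       ≡⟨ cong₂ U._+_ (toℚᵘ-ℕ→ℚ m) (toℚᵘ-ℕ→ℚ k) ⟩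
      mkℚᵘ (+ m) 0 U.+ mkℚᵘ (+ k) 0       ≈⟨ *≡* (cong (ℤ._* + 1) sum) ⟩
      mkℚᵘ (+ (m ℕ.+ k)) 0                ≡⟨ sym (toℚᵘ-ℕ→ℚ (m ℕ.+ k)) ⟩
      toℚᵘ (ℕ→ℚ (m ℕ.+ k))                ∎))
    where
    open UP.≃-Reasoning
    sum : + m ℤ.* + 1 ℤ.+ + k ℤ.* + 1 ≡ + (m ℕ.+ k)
    sum = trans (cong₂ ℤ._+_ (ℤP.*-identityʳ (+ m)) (ℤP.*-identityʳ (+ k))) (sym (ℤP.pos-+ m k))

  ℕ→ℚ-difference : ∀ b k → ℕ→ℚ (b ℕ.+ k) - ℕ→ℚ b ≡ ℕ→ℚ k
  ℕ→ℚ-difference b k = trans (cong (_- ℕ→ℚ b) (ℕ→ℚ-+ b k)) (xyx⁻¹≈y (ℕ→ℚ b) (ℕ→ℚ k))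

  ∣-∣-swap : ∀ p q → ∣ p - q ∣ ≡ ∣ q - p ∣
  ∣-∣-swap p q = trans (sym (∣-p∣≡∣p∣ (p - q))) (cong ∣_∣ (⁻¹-anti-homo‿- p q))

  numerator-product : ∀ a n → (+ a ℤ.* + n) ℤ.* + 1 ≡ + (a ℕ.* n)
  numerator-product a n = trans (ℤP.*-identityʳ _) (sym (ℤP.pos-* a n))

  denominator-product : ∀ b d → + d ℤ.* + suc (b ℕ.* 1) ≡ + (suc b ℕ.* d)
  denominator-product b d = trans (sym (ℤP.pos-* d (suc (b ℕ.* 1))))
    (cong +_ (trans (ℕP.*-comm d _) (cong (λ m → suc m ℕ.* d) (ℕP.*-identityʳ b))))

  ratio-below : ∀ c a b n d → toℚᵘ c ≡ mkℚᵘ (+ a) b → c * ℕ→ℚ n ≤ ℕ→ℚ d → a ℕ.* n ℕ.≤ suc b ℕ.* d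
  ratio-below c a b n d c≡ c*n≤d =
    cross-multiply (subst₂ U._≤_ (cong₂ U._*_ c≡ (toℚᵘ-ℕ→ℚ n)) (toℚᵘ-ℕ→ℚ d)
      (UP.≤-respˡ-≃ (toℚᵘ-homo-* c (ℕ→ℚ n)) (toℚᵘ-mono-≤ c*n≤d)))
    where
    cross-multiply : mkℚᵘ (+ a) b U.* mkℚᵘ (+ n) 0 U.≤ mkℚᵘ (+ d) 0 → a ℕ.* n ℕ.≤ suc b ℕ.* d
    cross-multiply (*≤* p) = ℤP.drop‿+≤+ (subst₂ ℤ._≤_ (numerator-product a n) (denominator-product b d) p)

  ratio-above : ∀ c a b n k → toℚᵘ c ≡ mkℚᵘ (+ a) b → ℕ→ℚ k ≤ c * ℕ→ℚ n → suc b ℕ.* k ℕ.≤ a ℕ.* n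
  ratio-above c a b n k c≡ k≤c*n =
    cross-multiply (subst₂ U._≤_ (toℚᵘ-ℕ→ℚ k) (cong₂ U._*_ c≡ (toℚᵘ-ℕ→ℚ n))
      (UP.≤-respʳ-≃ (toℚᵘ-homo-* c (ℕ→ℚ n)) (toℚᵘ-mono-≤ k≤c*n)))
    where
    cross-multiply : mkℚᵘ (+ k) 0 U.≤ mkℚᵘ (+ a) b U.* mkℚᵘ (+ n) 0 → suc b ℕ.* k ℕ.≤ a ℕ.* n
    cross-multiply (*≤* p) = ℤP.drop‿+≤+ (subst₂ ℤ._≤_ (denominator-product b k) (numerator-product a n) p)

  lower-at-ε₀ : ∀ {ε} c n d → ε ≤ ε₀ → (c - ε) * ℕ→ℚ n ≤ ℕ→ℚ d → (c - ε₀) * ℕ→ℚ n ≤ ℕ→ℚ d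
  lower-at-ε₀ c n d ε≤ε₀ =
    ≤-trans (*-monoʳ-≤-nonNeg (ℕ→ℚ n) {{ℕ→ℚ-nonNeg n}} (+-monoʳ-≤ c (neg-antimono-≤ ε≤ε₀)))

  quarter-degree : ∀ {ε} n d → ε ≤ ε₀ → (¼ - ε) * ℕ→ℚ n ≤ ℕ→ℚ d → 249 ℕ.* n ℕ.≤ 1000 ℕ.* d
  quarter-degree n d ε≤ε₀ h = ratio-below (¼ - ε₀) 249 999 n d refl (lower-at-ε₀ ¼ n d ε≤ε₀ h)

  half-degree : ∀ {ε} n d → ε ≤ ε₀ → (½ - ε) * ℕ→ℚ n ≤ ℕ→ℚ d → 499 ℕ.* n ℕ.≤ 1000 ℕ.* d
  half-degree n d ε≤ε₀ h = ratio-below (½ - ε₀) 499 999 n d refl (lower-at-ε₀ ½ n d ε≤ε₀ h)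

  at-most-ε : ∀ {ε} n k → ε ≤ ε₀ → ℕ→ℚ k ≤ ε * ℕ→ℚ n → 1000 ℕ.* k ℕ.≤ n
  at-most-ε n k ε≤ε₀ h = subst (1000 ℕ.* k ℕ.≤_) (ℕP.*-identityˡ n)
    (ratio-above ε₀ 1 999 n k refl (≤-trans h (*-monoʳ-≤-nonNeg (ℕ→ℚ n) {{ℕ→ℚ-nonNeg n}} ε≤ε₀)))

  close : ∀ {ε} n a b → ε ≤ ε₀ → ∣ ℕ→ℚ a - ℕ→ℚ b ∣ ≤ ε * ℕ→ℚ n → 1000 ℕ.* a ℕ.≤ 1000 ℕ.* b ℕ.+ n
  close {ε} n a b ε≤ε₀ h with ℕP.≤-total a b
  ... | inj₁ a≤b = ℕP.≤-trans (ℕP.*-monoʳ-≤ 1000 a≤b) (ℕP.m≤m+n _ _)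
  ... | inj₂ b≤a with ℕP.m≤n⇒∃[o]m+o≡n b≤a
  ...   | k , refl = subst (ℕ._≤ 1000 ℕ.* b ℕ.+ n) (sym (ℕP.*-distribˡ-+ 1000 b k))
                      (ℕP.+-monoʳ-≤ (1000 ℕ.* b) (at-most-ε n k ε≤ε₀ excess))
    where
    excess : ℕ→ℚ k ≤ ε * ℕ→ℚ n
    excess = subst (_≤ ε * ℕ→ℚ n)
      (trans (cong ∣_∣ (ℕ→ℚ-difference b k)) (0≤p⇒∣p∣≡p (nonNegative⁻¹ (ℕ→ℚ k) {{ℕ→ℚ-nonNeg k}}))) h

  dense-class : ∀ {n ε} {G : Graph n} {S S′ : Fin n → Bool} {e₁ e₂ : Fin n} → ε ≤ ε₀ →
    count S ℕ.+ count S′ ≡ n →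
    ∣ ℕ→ℚ (count S) - ℕ→ℚ (count S′) ∣ ≤ ε * ℕ→ℚ n →
    ℕ→ℚ (lowDegCount ε G S) ≤ ε * ℕ→ℚ n →
    (∀ u → S u ≡ true → (¼ - ε) * ℕ→ℚ n ≤ ℕ→ℚ (deg G u S)) →
    (∀ u w → S u ≡ true → S w ≡ false → Edge G u w → u ≡ e₁ ⊎ u ≡ e₂) →
    DenseClass G S
  dense-class {n} {ε} {G} {S} {S′} {e₁} {e₂} ε≤ε₀ total balance few-low min-degree exits = record
    { high        = λ u → ⌊ (½ - ε) * ℕ→ℚ n ≤? ℕ→ℚ (deg G u S) ⌋
    ; exit₁       = e₁
    ; exit₂       = e₂
    ; exits       = exits
    ; size        = majority-bound {b = count S′} total (close n (count S) (count S′) ε≤ε₀ balance)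
    ; few-low     = at-most-ε n (lowDegCount ε G S) ε≤ε₀ few-low
    ; min-degree  = λ u Su → quarter-degree n (deg G u S) ε≤ε₀ (min-degree u Su)
    ; high-degree = λ u _ high → half-degree n (deg G u S) ε≤ε₀ (toWitness (subst T (sym high) tt))
    }

open import Defs
open import Data.Nat using (ℕ) renaming (_≤_ to _≤ℕ_; _*_ to _*ℕ_)
open import Data.Fin using (Fin)
open import Data.Bool using (Bool; true; false)
open import Data.List using (List; length)
open import Data.List.Relation.Unary.All using (All)
open import Data.List.Relation.Unary.Unique.Propositional using (Unique)
open import Data.Rational using (ℚ; 0ℚ; _<_; _≤_)
open import Data.Product using (∃; _×_; _,_)
open import Data.Sum using (_⊎_)
open import Relation.Binary.PropositionalEquality using (_≡_; _≢_)
open import Relation.Nullary using (¬_)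

open import Data.Bool using (not)
open import Data.Nat.Properties using (+-comm)
open import Data.Rational using (1ℚ; _*_)
open import Data.Rational.Properties using (positive⁻¹)
open import Data.Product using (proj₁; proj₂)
open import Data.Sum using (inj₁; inj₂)
import Data.Sum as Sum
open import Data.Empty using (⊥-elim)
open import Relation.Binary.PropositionalEquality using (refl; trans; cong; subst) renaming (sym to ≡-sym)
open Counting using (count-complement)
open Switchings using (DenseClass; ManySwitchings; edge-sym; not-true; not-false; module Core)
open FromSuperExtremal using (ε₀; dense-class; ∣-∣-swap)

CrossEdges : ∀ {n} → Graph n → (Fin n → Bool) → (a₁ b₁ a₂ b₂ : Fin n) → Set
CrossEdges G inA a₁ b₁ a₂ b₂ = ∀ u v → inA u ≡ true → inA v ≡ false → Edge G u v →
  (u ≡ a₁ × v ≡ b₁) ⊎ (u ≡ a₂ × v ≡ b₂)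

class-A : ∀ {n ε} {G : Graph n} {inA a₁ b₁ a₂ b₂} → CrossEdges G inA a₁ b₁ a₂ b₂ →
  ε ≤ ε₀ → SuperExtremal ε G inA → DenseClass G inA
class-A {inA = inA} cross ε≤ε₀ (A1 , A2 , A3 , _ , _) =
  dense-class ε≤ε₀ (count-complement inA) A1 A2 A3
    (λ u v u∈A v∈B uv → Sum.map proj₁ proj₁ (cross u v u∈A v∈B uv))

class-B : ∀ {n ε} {G : Graph n} {inA a₁ b₁ a₂ b₂} → CrossEdges G inA a₁ b₁ a₂ b₂ →
  ε ≤ ε₀ → SuperExtremal ε G inA → DenseClass G (compl inA)
class-B {n} {ε} {G} {inA} cross ε≤ε₀ (A1 , _ , _ , A4 , A5) =
  dense-class ε≤ε₀ (trans (+-comm (count (compl inA)) (count inA)) (count-complement inA))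
    (subst (_≤ ε * ℕ→ℚ n) (∣-∣-swap (ℕ→ℚ (count inA)) (ℕ→ℚ (count (compl inA)))) A1)
    A4 (λ u u∈B → A5 u (not-true u∈B))
    (λ u v u∈B v∈A uv → Sum.map proj₂ proj₂ (cross v u (not-false v∈A) (not-true u∈B) (edge-sym G uv)))

same-class : ∀ {n} {G : Graph n} {inA a₁ b₁ a₂ b₂} → CrossEdges G inA a₁ b₁ a₂ b₂ →
  (H : DirHamCycle G) (x : Fin n) →
  ¬ (SamePair x (succ H x) a₁ b₁ ⊎ SamePair x (succ H x) a₂ b₂) → inA x ≡ inA (succ H x)
same-class {G = G} {inA} cross H x e∉Z with inA x in x∈ | inA (succ H x) in sx∈
... | true  | true  = refl
... | false | false = refl
... | true  | false with cross x (succ H x) x∈ sx∈ (edges H x)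
...   | inj₁ e=a₁b₁ = ⊥-elim (e∉Z (inj₁ (inj₁ e=a₁b₁)))
...   | inj₂ e=a₂b₂ = ⊥-elim (e∉Z (inj₂ (inj₁ e=a₂b₂)))
same-class {G = G} {inA} cross H x e∉Z | false | true with cross (succ H x) x sx∈ x∈ (edge-sym G (edges H x))
...   | inj₁ (sx≡a₁ , x≡b₁) = ⊥-elim (e∉Z (inj₁ (inj₂ (x≡b₁ , sx≡a₁))))
...   | inj₂ (sx≡a₂ , x≡b₂) = ⊥-elim (e∉Z (inj₂ (inj₂ (x≡b₂ , sx≡a₂))))

switchings-in-class : ∀ {n ε} {G : Graph n} {inA a₁ b₁ a₂ b₂} → CrossEdges G inA a₁ b₁ a₂ b₂ →
  ε ≤ ε₀ → 1500 ≤ℕ n → SuperExtremal ε G inA →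
  (H : DirHamCycle G) (x : Fin n) → inA x ≡ inA (succ H x) → ManySwitchings H x
switchings-in-class {inA = inA} cross ε≤ε₀ large ext H x same = in-class (inA x) refl
  where
  -- case split on the class of x (a `with` would abstract inA x in the rational hypotheses)
  in-class : ∀ c → inA x ≡ c → ManySwitchings H x
  in-class true  x∈A = Core.many-switchings (class-A cross ε≤ε₀ ext) H x large x∈A (trans (≡-sym same) x∈A)
  in-class false x∈B = Core.many-switchings (class-B cross ε≤ε₀ ext) H x large
                         (cong not x∈B) (cong not (trans (≡-sym same) x∈B))

lemma18 :
    ∃ λ (ε₀ : ℚ) → 0ℚ < ε₀ ×
    (∀ (ε : ℚ) → 0ℚ < ε → ε ≤ ε₀ →
      ∃ λ (μ₀ : ℚ) → 0ℚ < μ₀ ×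
      (∀ (μ : ℚ) → 0ℚ < μ → μ ≤ μ₀ →
        ∃ λ (n₀ : ℕ) →
        ∀ (n : ℕ) → n₀ ≤ℕ n →
        ∀ (G : Graph n) (inA : Fin n → Bool) → SuperExtremal ε G inA →
        ∀ (a₁ b₁ a₂ b₂ : Fin n) →
        inA a₁ ≡ true → inA b₁ ≡ false → inA a₂ ≡ true → inA b₂ ≡ false →
        a₁ ≢ a₂ → b₁ ≢ b₂ →
        Edge G a₁ b₁ → Edge G a₂ b₂ →
        (∀ u v → inA u ≡ true → inA v ≡ false → Edge G u v →
          (u ≡ a₁ × v ≡ b₁) ⊎ (u ≡ a₂ × v ≡ b₂)) →
        (H : DirHamCycle G) →
        ∀ (x : Fin n) →
        ¬ (SamePair x (succ H x) a₁ b₁ ⊎ SamePair x (succ H x) a₂ b₂) →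
        ∃ λ (L : List (Fin n × Fin n × SwitchIndex)) →
          Unique L × All (Admissible H x) L × n *ℕ n ≤ℕ 300 *ℕ length L))
lemma18 =
  ε₀ , positive⁻¹ ε₀ , λ ε _ ε≤ε₀ →
  1ℚ , positive⁻¹ 1ℚ , λ _ _ _ →
  1500 , λ n large G inA ext a₁ b₁ a₂ b₂ _ _ _ _ _ _ _ _ cross H x e∉Z →
  switchings-in-class cross ε≤ε₀ large ext H x (same-class cross H x e∉Z)
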